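{- An odd positive integer $n$ belongs to $O_{\mathrm{FS}}$ if and only if one of the following holds: (i) $\mathrm{ord}_n(2)=\varphi(n)$; (ii) $\mathrm{ord}_n(2)=\varphi(n)/2$ and either $4\nmid\varphi(n)$ or $2^{\varphi(n)/4}\not\equiv-1\pmod n$.
   Context: $O_{\mathrm{FS}}$ is the set of odd integers $n\ge1$ such that for every $x\in\mathbb Z$ coprime to $n$ there exists $j\ge0$ with $n\mid x-2^j$ or $n\mid x+2^j$. $\mathrm{ord}_n(2)$ is the multiplicative order of $2$ modulo $n$ and $\varphi$ is Euler's totient function. -}

module Defs where

open import Data.Nat using (ℕ; suc; _^_; _<_; _≤_; _%_; NonZero)
open import Data.Nat.Divisibility using (_∣_)
open import Data.Nat.Coprimality using (Coprime)
open import Data.Nat.GCD using (gcd)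
open import Data.List using (List; length; filter; upTo; map)
open import Data.Nat using (_≟_)
open import Data.Integer as ℤ using (ℤ; +_; ∣_∣)
import Data.Integer.Divisibility as ℤD
open import Data.Product using (_×_; ∃)
open import Data.Sum using (_⊎_)
open import Relation.Nullary using (¬_)
open import Relation.Binary.PropositionalEquality using (_≡_)

φ : ℕ → ℕ
φ n = length (filter (λ k → gcd k n ≟ 1) (map suc (upTo n)))

IsMultOrder : ℕ → ℕ → ℕ → Set
IsMultOrder n a k =
  (0 < k) × ((+ n) ℤD.∣ ((+ (a ^ k)) ℤ.- (+ 1))) ×
  (∀ m → 0 < m → (+ n) ℤD.∣ ((+ (a ^ m)) ℤ.- (+ 1)) → k ≤ m)

Odd : ℕ → Set
Odd n = ¬ (2 ∣ n)

InOFS : ℕ → Set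
InOFS n = ∀ (x : ℤ) → Coprime ∣ x ∣ n →
  ∃ λ (j : ℕ) → ((+ n) ℤD.∣ (x ℤ.- (+ (2 ^ j)))) ⊎ ((+ n) ℤD.∣ (x ℤ.+ (+ (2 ^ j))))

module Submission where

-- Let d be the order of 2 modulo n.  Membership in O_FS says that the residues ±2^j exhaust the
-- φ(n) reduced residues, which happens exactly when there are φ(n) of them.  If -1 is a power of 2,
-- these residues are the d powers of 2, so n ∈ O_FS iff d = φ(n); otherwise they are 2d distinct
-- residues, so n ∈ O_FS iff 2d = φ(n).  For the converse under (ii): φ(n) is even (c ↦ n - c pairs
-- up the reduced residues), and when d = φ(n)/2 a power 2^r ≡ -1 with 0 < r < d forces 2r = d,
-- i.e. r = φ(n)/4, which the side condition excludes.

open import Defs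
open import Data.Nat as ℕ using (ℕ; zero; suc; _≤_; _<_; z≤n; s≤s; z<s; _∸_; _^_; NonZero; _≟_; _<?_)
import Data.Nat.Properties as ℕP
import Data.Nat.DivMod as ℕDM
open import Data.Nat.Divisibility as ℕD using (divides)
open import Data.Nat.Coprimality using (Coprime; coprime⇒gcd≡1; gcd≡1⇒coprime; 0-coprimeTo-m⇒m≡1)
open import Data.Nat.GCD as GCD using (gcd)
open import Data.Nat.Induction using (<-rec)
import Data.Nat.Tactic.RingSolver as ℕSolver
import Data.Fin as Fin
import Data.Fin.Properties as FP
open import Data.List using (List; []; _∷_; [_]; length; filter; map; upTo; applyUpTo; _++_)
open import Data.List.Properties
  using (filter-notAll; filter-++; length-++; length-applyUpTo; map-upTo; upTo-∷ʳ)
open import Data.List.Membership.Propositional using (_∈_)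
open import Data.List.Membership.Propositional.Properties
  using (∈-filter⁺; ∈-filter⁻; ∈-upTo⁺; ∈-upTo⁻; ∈-applyUpTo⁺; ∈-applyUpTo⁻; ∈-++⁺ˡ; ∈-++⁺ʳ; ∈-++⁻)
import Data.List.Membership.DecPropositional as DecMembership
open import Data.List.Relation.Binary.Subset.Propositional using (_⊆_)
open import Data.List.Relation.Binary.Disjoint.Propositional using (Disjoint)
open import Data.List.Relation.Unary.Unique.Propositional using (Unique)
import Data.List.Relation.Unary.Unique.Propositional.Properties as Unique
open import Data.List.Relation.Unary.AllPairs using (_∷_)
import Data.List.Relation.Unary.All as All
open import Data.List.Relation.Unary.All.Properties using (¬Any⇒All¬)
import Data.List.Relation.Unary.Any as Any
open import Data.List.Relation.Unary.Any using (here; there)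
open import Data.Empty using (⊥; ⊥-elim)
open import Data.Product using (∃; _×_; _,_; proj₁; proj₂)
open import Data.Sum using (_⊎_; inj₁; inj₂)
open import Function using (_∘_; id; _⇔_; mk⇔; Equivalence)
open Equivalence using (to; from)
open import Relation.Nullary using (¬_; Dec; yes; no; ¬?; contradiction)
import Relation.Nullary.Decidable as Dec
open import Relation.Nullary.Decidable using (_×-dec_)
open import Relation.Unary using (Pred; Decidable)
open import Relation.Binary using (Setoid; DecidableEquality)
open import Relation.Binary.PropositionalEquality hiding ([_])

-- ℕ arithmetic is opened only locally: the integer modules below use ℤ's operators unqualified.
module _ where
  open import Data.Nat using (_+_)

  module _ {a b} {A : Set a} {B : Set b} (_≟_ : DecidableEquality B) where

    length-≤-injectiveOn : ∀ {xs : List A} {ys : List B} (f : A → B) → Unique xs →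
      (∀ {x} → x ∈ xs → f x ∈ ys) → (∀ {x y} → x ∈ xs → y ∈ xs → f x ≡ f y → x ≡ y) →
      length xs ≤ length ys
    length-≤-injectiveOn {[]} f _ _ _ = z≤n
    length-≤-injectiveOn {x ∷ xs} {ys} f (x∉xs ∷ xs!) into injective =
      ℕP.≤-trans (s≤s (length-≤-injectiveOn f xs! into-others (λ p q → injective (there p) (there q))))
                 (filter-notAll other? ys (Any.map (λ { refl fx≢fx → fx≢fx refl }) (into (here refl))))
      where
      other? = λ y → ¬? (y ≟ f x)
      into-others : ∀ {y} → y ∈ xs → f y ∈ filter other? ys
      into-others y∈xs = ∈-filter⁺ other? (into (there y∈xs))
        (λ fy≡fx → All.lookup x∉xs y∈xs (injective (here refl) (there y∈xs) (sym fy≡fx)))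

  module _ {a} {A : Set a} (_≟_ : DecidableEquality A) where
    open DecMembership _≟_ using (_∈?_)

    length-≤-⊆ : ∀ {xs ys : List A} → Unique xs → xs ⊆ ys → length xs ≤ length ys
    length-≤-⊆ xs! xs⊆ys = length-≤-injectiveOn _≟_ id xs! xs⊆ys (λ _ _ → id)

    length-≤⇒⊇ : ∀ {xs ys : List A} → Unique xs → xs ⊆ ys → length ys ≤ length xs → ys ⊆ xs
    length-≤⇒⊇ {xs} {ys} xs! xs⊆ys |ys|≤|xs| {y} y∈ys with y ∈? xs
    ... | yes y∈xs = y∈xs
    ... | no y∉xs = ⊥-elim (ℕP.<-irrefl refl
          (ℕP.≤-trans (length-≤-⊆ (¬Any⇒All¬ xs y∉xs ∷ xs!) y∷xs⊆ys) |ys|≤|xs|))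
      where
      y∷xs⊆ys : y ∷ xs ⊆ ys
      y∷xs⊆ys (here refl) = y∈ys
      y∷xs⊆ys (there p) = xs⊆ys p

    ⊇⇔length-≡ : ∀ {xs ys : List A} → Unique xs → Unique ys → xs ⊆ ys →
      (ys ⊆ xs ⇔ length ys ≡ length xs)
    ⊇⇔length-≡ {xs} {ys} xs! ys! xs⊆ys = mk⇔
      (λ (ys⊆xs : ys ⊆ xs) → ℕP.≤-antisym (length-≤-⊆ {ys} ys! ys⊆xs) (length-≤-⊆ {xs} xs! xs⊆ys))
      (λ |ys|≡|xs| → length-≤⇒⊇ xs! xs⊆ys (ℕP.≤-reflexive |ys|≡|xs|))

    length-filter-+-length-filter-¬ : ∀ {p} {P : Pred A p} (P? : Decidable P) xs →
      length (filter P? xs) + length (filter (¬? ∘ P?) xs) ≡ length xs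
    length-filter-+-length-filter-¬ P? [] = refl
    length-filter-+-length-filter-¬ P? (x ∷ xs) with P? x
    ... | yes _ = cong suc (length-filter-+-length-filter-¬ P? xs)
    ... | no _ = trans (ℕP.+-suc _ _) (cong suc (length-filter-+-length-filter-¬ P? xs))

    length-even-by-involution : ∀ {p} {P : Pred A p} (P? : Decidable P) (f : A → A) {xs : List A} →
      Unique xs → (∀ {x} → x ∈ xs → f x ∈ xs) → (∀ {x} → x ∈ xs → f (f x) ≡ x) →
      (∀ {x} → x ∈ xs → P x → ¬ P (f x)) → (∀ {x} → x ∈ xs → ¬ P x → P (f x)) →
      length xs ≡ length (filter P? xs) + length (filter P? xs)
    length-even-by-involution P? f {xs} xs! closed involutive P⇒¬Pf ¬P⇒Pf = begin
      length xs                                             ≡⟨ length-filter-+-length-filter-¬ P? xs ⟨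
      length (filter P? xs) + length (filter (¬? ∘ P?) xs)  ≡⟨ cong (length (filter P? xs) +_) ¬P≡P ⟩
      length (filter P? xs) + length (filter P? xs)         ∎
      where
      open ≡-Reasoning
      injective : ∀ {x y} → x ∈ xs → y ∈ xs → f x ≡ f y → x ≡ y
      injective x∈ y∈ fx≡fy = trans (sym (involutive x∈)) (trans (cong f fx≡fy) (involutive y∈))
      P≤¬P : length (filter P? xs) ≤ length (filter (¬? ∘ P?) xs)
      P≤¬P = length-≤-injectiveOn _≟_ f (Unique.filter⁺ P? xs!)
        (λ x∈ → let x∈xs , Px = ∈-filter⁻ P? x∈ in ∈-filter⁺ (¬? ∘ P?) (closed x∈xs) (P⇒¬Pf x∈xs Px))
        (λ x∈ y∈ → injective (proj₁ (∈-filter⁻ P? x∈)) (proj₁ (∈-filter⁻ P? y∈)))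
      ¬P≤P : length (filter (¬? ∘ P?) xs) ≤ length (filter P? xs)
      ¬P≤P = length-≤-injectiveOn _≟_ f (Unique.filter⁺ (¬? ∘ P?) xs!)
        (λ x∈ → let x∈xs , ¬Px = ∈-filter⁻ (¬? ∘ P?) x∈ in ∈-filter⁺ P? (closed x∈xs) (¬P⇒Pf x∈xs ¬Px))
        (λ x∈ y∈ → injective (proj₁ (∈-filter⁻ (¬? ∘ P?) x∈)) (proj₁ (∈-filter⁻ (¬? ∘ P?) y∈)))
      ¬P≡P : length (filter (¬? ∘ P?) xs) ≡ length (filter P? xs)
      ¬P≡P = ℕP.≤-antisym ¬P≤P P≤¬P

  length-filter-shift : ∀ {p} {P : Pred ℕ p} (P? : Decidable P) n → (P 0 ⇔ P n) →
    length (filter P? (map suc (upTo n))) ≡ length (filter P? (upTo n))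
  length-filter-shift {P = P} P? n P0⇔Pn = ℕP.+-cancelˡ-≡ (count [ 0 ]) _ _ (begin
    count [ 0 ] + count (map suc (upTo n))          ≡⟨ count-∷ 0 _ ⟨
    count (0 ∷ map suc (upTo n))                    ≡⟨ cong (λ xs → count (0 ∷ xs)) (map-upTo suc n) ⟩
    count (upTo (suc n))                            ≡⟨ cong count (upTo-∷ʳ n) ⟨
    count (upTo n ++ [ n ])                         ≡⟨ cong length (filter-++ P? (upTo n) [ n ]) ⟩
    length (filter P? (upTo n) ++ filter P? [ n ])  ≡⟨ length-++ (filter P? (upTo n)) ⟩
    count (upTo n) + count [ n ]                    ≡⟨ ℕP.+-comm (count (upTo n)) _ ⟩
    count [ n ] + count (upTo n)                    ≡⟨ cong (_+ count (upTo n)) count[0]≡count[n] ⟨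
    count [ 0 ] + count (upTo n)                    ∎)
    where
    open ≡-Reasoning
    count : List ℕ → ℕ
    count xs = length (filter P? xs)
    count-∷ : ∀ x xs → count (x ∷ xs) ≡ count [ x ] + count xs
    count-∷ x xs with P? x
    ... | yes _ = refl
    ... | no _ = refl
    count[0]≡count[n] : count [ 0 ] ≡ count [ n ]
    count[0]≡count[n] with P? 0 | P? n
    ... | yes _ | yes _ = refl
    ... | no _ | no _ = refl
    ... | yes P0 | no ¬Pn = contradiction (to P0⇔Pn P0) ¬Pn
    ... | no ¬P0 | yes Pn = contradiction (from P0⇔Pn Pn) ¬P0

  ∃-least : ∀ {p} {P : Pred ℕ p} → Decidable P → ∀ {m} → P m →
    ∃ λ k → P k × (∀ {j} → P j → k ≤ j)
  ∃-least {P = P} P? {m} = <-rec (λ m → P m → ∃ λ k → P k × (∀ {j} → P j → k ≤ j)) least-below m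
    where
    least-below : ∀ m → (∀ {k} → k < m → P k → ∃ λ k → P k × (∀ {j} → P j → k ≤ j)) →
                  P m → ∃ λ k → P k × (∀ {j} → P j → k ≤ j)
    least-below m below Pm with ℕP.anyUpTo? P? m
    ... | yes (k , k<m , Pk) = below k<m Pk
    ... | no nothing-below = m , Pm , λ {j} Pj → ℕP.≮⇒≥ (λ j<m → nothing-below (j , j<m , Pj))

module _ where
  open import Data.Nat using (_+_; _*_; _/_; _%_)

  double≡*2 : ∀ t → t + t ≡ t * 2
  double≡*2 t = trans (cong (t +_) (sym (ℕP.+-identityʳ t))) (ℕP.*-comm 2 t)

  double/2≡ : ∀ t → (t + t) / 2 ≡ t
  double/2≡ t = trans (cong (_/ 2) (double≡*2 t)) (ℕDM.m*n/n≡m t 2)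

  even⇒≡half+half : ∀ {m} → 2 ℕD.∣ m → m ≡ m / 2 + m / 2
  even⇒≡half+half {m} 2∣m = trans (sym (ℕDM.m/n*n≡m 2∣m)) (sym (double≡*2 (m / 2)))

  odd⇒≡1+[n/2]*2 : ∀ {n} → Odd n → n ≡ 1 + (n / 2) * 2
  odd⇒≡1+[n/2]*2 {n} odd = trans (ℕDM.m≡m%n+[m/n]*n n 2) (cong (_+ (n / 2) * 2) n%2≡1)
    where
    n%2≡1 : n % 2 ≡ 1
    n%2≡1 with n % 2 | ℕDM.m%n<n n 2 | ℕD.m%n≡0⇒n∣m n 2
    ... | 0 | _ | 2∣n = contradiction (2∣n refl) odd
    ... | 1 | _ | _ = refl
    ... | suc (suc _) | s≤s (s≤s ()) | _

  odd⇒∸≢ : ∀ {n c} → Odd n → c ≤ n → n ∸ c ≢ c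
  odd⇒∸≢ {n} {c} odd c≤n n∸c≡c = odd (divides c (begin
    n          ≡⟨ ℕP.m∸n+n≡m c≤n ⟨
    n ∸ c + c  ≡⟨ cong (_+ c) n∸c≡c ⟩
    c + c      ≡⟨ double≡*2 c ⟩
    c * 2      ∎))
    where open ≡-Reasoning

  odd-∣2⇒≡1 : ∀ {n} → Odd n → n ℕD.∣ 2 → n ≡ 1
  odd-∣2⇒≡1 {zero} _ 0∣2 = contradiction (ℕD.0∣⇒≡0 0∣2) λ ()
  odd-∣2⇒≡1 {1} _ _ = refl
  odd-∣2⇒≡1 {2} odd _ = contradiction ℕD.∣-refl odd
  odd-∣2⇒≡1 {suc (suc (suc n))} _ n∣2 = contradiction (ℕD.∣⇒≤ n∣2) λ { (s≤s (s≤s ())) }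

  coprime-∸ : ∀ {c n} → c ≤ n → Coprime c n → Coprime (n ∸ c) n
  coprime-∸ {c} c≤n c⊥n (i∣n∸c , i∣n) =
    c⊥n (ℕD.∣m+n∣m⇒∣n (subst (_ ℕD.∣_) (sym (ℕP.m∸n+n≡m c≤n)) i∣n) i∣n∸c , i∣n)

  φ/2-positive⇒≢1 : ∀ {n} → 0 < φ n / 2 → n ≢ 1
  φ/2-positive⇒≢1 0<φ/2 refl = ℕP.<-irrefl refl 0<φ/2

module Modulo (n : ℕ) where
  open import Data.Integer as ℤ using (ℤ; +_; ∣_∣; _+_; _*_; _-_; -_)
  import Data.Integer.Properties as ℤP
  import Data.Integer.DivMod as ℤDM
  import Data.Integer.Divisibility as ℤD
  open import Data.Integer.Divisibility.Signed as S using (_∣_)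
  open import Data.Integer.Tactic.RingSolver using (solve-∀; solve)

  infix 4 _≈_ _≈?_
  -- A record rather than an abbreviation, so that a and b can be inferred from a proof of a ≈ b.
  record _≈_ (a b : ℤ) : Set where
    constructor mk≈
    field n∣a-b : + n ∣ a - b
  open _≈_ public

  ≈-by : ∀ {e a b} → + n ∣ e → e ≡ a - b → a ≈ b
  ≈-by n∣e refl = mk≈ n∣e

  ≈-refl : ∀ {a} → a ≈ a
  ≈-refl {a} = ≈-by (S.divides (+ 0) refl) (solve (a ∷ []))

  ≈-reflexive : ∀ {a b} → a ≡ b → a ≈ b
  ≈-reflexive refl = ≈-refl

  ≈-sym : ∀ {a b} → a ≈ b → b ≈ a
  ≈-sym {a} {b} (mk≈ n∣a-b) = ≈-by (S.∣m⇒∣-m n∣a-b) (solve (a ∷ b ∷ []))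

  ≈-trans : ∀ {a b c} → a ≈ b → b ≈ c → a ≈ c
  ≈-trans {a} {b} {c} (mk≈ n∣a-b) (mk≈ n∣b-c) = ≈-by (S.∣m∣n⇒∣m+n n∣a-b n∣b-c) (solve (a ∷ b ∷ c ∷ []))

  ≈-setoid : Setoid _ _
  ≈-setoid = record { Carrier = ℤ ; _≈_ = _≈_
    ; isEquivalence = record { refl = ≈-refl ; sym = ≈-sym ; trans = ≈-trans } }

  *-cong : ∀ {a b c d} → a ≈ b → c ≈ d → a * c ≈ b * d
  *-cong {a} {b} {c} {d} (mk≈ n∣a-b) (mk≈ n∣c-d) =
    ≈-by (S.∣m∣n⇒∣m+n (S.∣m⇒∣m*n c n∣a-b) (S.∣n⇒∣m*n b n∣c-d)) (solve (a ∷ b ∷ c ∷ d ∷ []))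

  -‿cong : ∀ {a b} → a ≈ b → - a ≈ - b
  -‿cong {a} {b} (mk≈ n∣a-b) = ≈-by (S.∣m⇒∣-m n∣a-b) (solve (a ∷ b ∷ []))

  -‿cancel : ∀ {a b} → - a ≈ - b → a ≈ b
  -‿cancel {a} {b} (mk≈ n∣-a+b) = ≈-by (S.∣m⇒∣-m n∣-a+b) (solve (a ∷ b ∷ []))

  _≈?_ : ∀ a b → Dec (a ≈ b)
  a ≈? b = Dec.map′ mk≈ n∣a-b (+ n S.∣? a - b)

  ≈⇒∣ᵤ : ∀ {a b} → a ≈ b → + n ℤD.∣ a - b
  ≈⇒∣ᵤ (mk≈ n∣a-b) = S.∣⇒∣ᵤ n∣a-b

  ∣ᵤ⇒≈ : ∀ {a b} → + n ℤD.∣ a - b → a ≈ b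
  ∣ᵤ⇒≈ n∣a-b = mk≈ (S.∣ᵤ⇒∣ n∣a-b)

  ≈-⇒∣ᵤ+ : ∀ {a b} → a ≈ - b → + n ℤD.∣ a + b
  ≈-⇒∣ᵤ+ {a} {b} (mk≈ n∣a+b) = S.∣⇒∣ᵤ {i = a + b} (subst (+ n ∣_) {a - - b} (solve (a ∷ b ∷ [])) n∣a+b)

  ∣ᵤ+⇒≈- : ∀ {a b} → + n ℤD.∣ a + b → a ≈ - b
  ∣ᵤ+⇒≈- {a} {b} n∣a+b = ≈-by (S.∣ᵤ⇒∣ {i = a + b} n∣a+b) (solve (a ∷ b ∷ []))

  coprime-cong : ∀ {a b} → a ≈ b → Coprime ∣ a ∣ n → Coprime ∣ b ∣ n
  coprime-cong {a} {b} (mk≈ n∣a-b) a⊥n {i} (i∣b , i∣n) = a⊥n (S.∣⇒∣ᵤ i∣a , i∣n)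
    where
    i∣a : + i ∣ a
    i∣a = subst (+ i ∣_) {a - b + b} (solve (a ∷ b ∷ []))
            (S.∣m∣n⇒∣m+n (S.∣-trans (S.∣ᵤ⇒∣ i∣n) n∣a-b) (S.∣ᵤ⇒∣ {+ i} {b} i∣b))

  1≉-1 : Odd n → n ≢ 1 → ¬ (+ 1 ≈ - + 1)
  1≉-1 odd n≢1 1≈-1 = n≢1 (odd-∣2⇒≡1 odd (≈⇒∣ᵤ 1≈-1))

  record Invertible (a : ℤ) : Set where
    constructor _,_
    field
      inverse : ℤ
      inverse-law : a * inverse ≈ + 1

  invertible-* : ∀ {a b} → Invertible a → Invertible b → Invertible (a * b)
  invertible-* {a} {b} (u , au≈1) (v , bv≈1) =
    u * v , ≈-trans (≈-reflexive {b = a * u * (b * v)} (solve (a ∷ b ∷ u ∷ v ∷ []))) (*-cong au≈1 bv≈1)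

  invertible⇒coprime : ∀ {a} → Invertible a → Coprime ∣ a ∣ n
  invertible⇒coprime {a} (u , mk≈ n∣au-1) {i} (i∣a , i∣n) = ℕD.∣1⇒≡1 (S.∣⇒∣ᵤ i∣1)
    where
    i∣1 : + i ∣ + 1
    i∣1 = subst (+ i ∣_) {a * u - (a * u - + 1)} (solve (a ∷ u ∷ []))
            (S.∣m∣n⇒∣m-n (S.∣m⇒∣m*n u (S.∣ᵤ⇒∣ {+ i} {a} i∣a)) (S.∣-trans (S.∣ᵤ⇒∣ i∣n) n∣au-1))

  *-cancelˡ : ∀ {c a b} → Invertible c → c * a ≈ c * b → a ≈ b
  *-cancelˡ {c} {a} {b} (u , cu≈1) ca≈cb = begin
    a            ≡⟨ solve (a ∷ []) ⟩
    + 1 * a      ≈⟨ *-cong cu≈1 (≈-refl {a}) ⟨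
    c * u * a    ≡⟨ solve (c ∷ u ∷ a ∷ []) ⟩
    u * (c * a)  ≈⟨ *-cong (≈-refl {u}) ca≈cb ⟩
    u * (c * b)  ≡⟨ solve (c ∷ u ∷ b ∷ []) ⟩
    c * u * b    ≈⟨ *-cong cu≈1 (≈-refl {b}) ⟩
    + 1 * b      ≡⟨ solve (b ∷ []) ⟩
    b            ∎
    where open import Relation.Binary.Reasoning.Setoid ≈-setoid

  invertible-2 : Odd n → Invertible (+ 2)
  invertible-2 odd = + h + + 1 , ≈-by S.∣-refl (begin
    + n                      ≡⟨ cong +_ (odd⇒≡1+[n/2]*2 odd) ⟩
    + (1 ℕ.+ h ℕ.* 2)        ≡⟨ ℤP.pos-+ 1 (h ℕ.* 2) ⟩
    + 1 + + (h ℕ.* 2)        ≡⟨ cong (λ x → + 1 + x) (ℤP.pos-* h 2) ⟩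
    + 1 + + h * + 2          ≡⟨ rearrange (+ h) ⟩
    + 2 * (+ h + + 1) - + 1  ∎)
    where
    open ≡-Reasoning
    h = n ℕ./ 2
    rearrange : ∀ k → + 1 + k * + 2 ≡ + 2 * (k + + 1) - + 1
    rearrange = solve-∀

  module Residues .{{_ : NonZero n}} where

    rem : ℤ → ℕ
    rem x = x ℤ.%ℕ n

    rem<n : ∀ x → rem x < n
    rem<n x = ℤDM.n%ℕd<d x n

    ≈-rem : ∀ x → x ≈ + rem x
    ≈-rem x = mk≈ (S.divides (x ℤ./ℕ n) (begin
      x - + rem x                               ≡⟨ cong (_- + rem x) (ℤDM.a≡a%ℕn+[a/ℕn]*n x n) ⟩
      (+ rem x + (x ℤ./ℕ n) * + n) - + rem x    ≡⟨ cancel (+ rem x) ((x ℤ./ℕ n) * + n) ⟩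
      (x ℤ./ℕ n) * + n                          ∎))
      where
      open ≡-Reasoning
      cancel : ∀ r m → (r + m) - r ≡ m
      cancel = solve-∀

    ≈-injective-≤ : ∀ {a b} → a ≤ b → b < n → + a ≈ + b → a ≡ b
    ≈-injective-≤ {a} {b} a≤b b<n a≈b = ℕP.≤-antisym a≤b (ℕP.m∸n≡0⇒m≤n (multiple-< n∣b∸a b∸a<n))
      where
      n∣b∸a : n ℕD.∣ b ∸ a
      n∣b∸a = subst (n ℕD.∣_) (trans (cong ∣_∣ (ℤP.m-n≡m⊖n a b)) (ℤP.∣⊖∣-≤ a≤b)) (≈⇒∣ᵤ a≈b)
      b∸a<n : b ∸ a < n
      b∸a<n = ℕP.≤-<-trans (ℕP.m∸n≤m b a) b<n
      multiple-< : ∀ {k} → n ℕD.∣ k → k < n → k ≡ 0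
      multiple-< {zero} _ _ = refl
      multiple-< {suc k} n∣k k<n = contradiction n∣k (ℕD.>⇒∤ k<n)

    ≈-injective-< : ∀ {a b} → a < n → b < n → + a ≈ + b → a ≡ b
    ≈-injective-< {a} {b} a<n b<n a≈b with ℕP.≤-total a b
    ... | inj₁ a≤b = ≈-injective-≤ a≤b b<n a≈b
    ... | inj₂ b≤a = sym (≈-injective-≤ b≤a a<n (≈-sym a≈b))

    rem-cong : ∀ {x y} → x ≈ y → rem x ≡ rem y
    rem-cong {x} {y} x≈y = ≈-injective-< (rem<n x) (rem<n y)
      (≈-trans (≈-sym (≈-rem x)) (≈-trans x≈y (≈-rem y)))

    rem-≡⇒≈ : ∀ x y → rem x ≡ rem y → x ≈ y
    rem-≡⇒≈ x y rx≡ry = ≈-trans (≈-rem x) (≈-trans (≈-reflexive (cong +_ rx≡ry)) (≈-sym (≈-rem y)))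

    rem-+ : ∀ {c} → c < n → rem (+ c) ≡ c
    rem-+ = ℕDM.m<n⇒m%n≡m

    reducedResidues : List ℕ
    reducedResidues = filter (λ c → gcd c n ≟ 1) (upTo n)

    reducedResidues-unique : Unique reducedResidues
    reducedResidues-unique = Unique.filter⁺ (λ c → gcd c n ≟ 1) (Unique.upTo⁺ n)

    φ≡length-reducedResidues : φ n ≡ length reducedResidues
    φ≡length-reducedResidues = length-filter-shift (λ c → gcd c n ≟ 1) n
      (mk⇔ (trans (sym gcd[0,n]≡gcd[n,n])) (trans gcd[0,n]≡gcd[n,n]))
      where
      gcd[0,n]≡gcd[n,n] : gcd 0 n ≡ gcd n n
      gcd[0,n]≡gcd[n,n] = ℕD.∣-antisym
        (GCD.gcd-greatest (GCD.gcd[m,n]∣n 0 n) (GCD.gcd[m,n]∣n 0 n))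
        (GCD.gcd-greatest (gcd n n ℕD.∣0) (GCD.gcd[m,n]∣n n n))

    ∈-reducedResidues⁺ : ∀ {c} → c < n → Coprime c n → c ∈ reducedResidues
    ∈-reducedResidues⁺ c<n c⊥n = ∈-filter⁺ (λ c → gcd c n ≟ 1) (∈-upTo⁺ c<n) (coprime⇒gcd≡1 c⊥n)

    ∈-reducedResidues⁻ : ∀ {c} → c ∈ reducedResidues → c < n × Coprime c n
    ∈-reducedResidues⁻ c∈ = let c∈upTo , gcd≡1 = ∈-filter⁻ (λ c → gcd c n ≟ 1) c∈ in
      ∈-upTo⁻ c∈upTo , gcd≡1⇒coprime gcd≡1

    rem∈reducedResidues : ∀ x → Coprime ∣ x ∣ n → rem x ∈ reducedResidues
    rem∈reducedResidues x x⊥n = ∈-reducedResidues⁺ (rem<n x) (coprime-cong (≈-rem x) x⊥n)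

    ⊇reducedResidues⇔φ≡length : ∀ {xs} → Unique xs → xs ⊆ reducedResidues →
      (reducedResidues ⊆ xs ⇔ φ n ≡ length xs)
    ⊇reducedResidues⇔φ≡length xs! xs⊆ = mk⇔
      (λ (⊇ : reducedResidues ⊆ _) → trans φ≡length-reducedResidues (to equiv ⊇))
      (λ φ≡ → from equiv (trans (sym φ≡length-reducedResidues) φ≡))
      where equiv = ⊇⇔length-≡ _≟_ xs! reducedResidues-unique xs⊆

    φ-even : Odd n → n ≢ 1 → 2 ℕD.∣ φ n
    φ-even odd n≢1 = divides t (trans φ≡t+t (double≡*2 t))
      where
      small? = λ c → c <? n ∸ c
      t = length (filter small? reducedResidues)
      c≤n : ∀ {c} → c ∈ reducedResidues → c ≤ n
      c≤n c∈ = ℕP.<⇒≤ (proj₁ (∈-reducedResidues⁻ c∈))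
      involutive : ∀ {c} → c ∈ reducedResidues → n ∸ (n ∸ c) ≡ c
      involutive c∈ = ℕP.m∸[m∸n]≡n (c≤n c∈)
      positive : ∀ {c} → Coprime c n → 0 < c
      positive {zero} 0⊥n = contradiction (0-coprimeTo-m⇒m≡1 0⊥n) n≢1
      positive {suc c} _ = z<s
      closed : ∀ {c} → c ∈ reducedResidues → n ∸ c ∈ reducedResidues
      closed c∈ = let c<n , c⊥n = ∈-reducedResidues⁻ c∈ in
        ∈-reducedResidues⁺ (ℕP.∸-monoʳ-< (positive c⊥n) (ℕP.<⇒≤ c<n)) (coprime-∸ (ℕP.<⇒≤ c<n) c⊥n)
      small⇒large : ∀ {c} → c ∈ reducedResidues → c < n ∸ c → ¬ (n ∸ c < n ∸ (n ∸ c))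
      small⇒large {c} c∈ c<n∸c n∸c<c = ℕP.<-asym c<n∸c (subst (n ∸ c <_) (involutive c∈) n∸c<c)
      large⇒small : ∀ {c} → c ∈ reducedResidues → ¬ (c < n ∸ c) → n ∸ c < n ∸ (n ∸ c)
      large⇒small {c} c∈ c≮n∸c = subst (n ∸ c <_) (sym (involutive c∈))
        (ℕP.≤∧≢⇒< (ℕP.≮⇒≥ c≮n∸c) (odd⇒∸≢ odd (c≤n c∈)))
      φ≡t+t : φ n ≡ t ℕ.+ t
      φ≡t+t = trans φ≡length-reducedResidues (length-even-by-involution _≟_ small? (n ∸_)
        reducedResidues-unique closed involutive small⇒large large⇒small)

module PowersOfTwo (n : ℕ) .{{_ : NonZero n}} (odd : Odd n) where
  open Modulo n
  open Residues
  open import Data.Integer using (ℤ; +_; _*_; -_)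
  import Data.Integer.Properties as ℤP

  pow : ℕ → ℤ
  pow j = + (2 ^ j)

  pow-+ : ∀ i j → pow (i ℕ.+ j) ≡ pow i * pow j
  pow-+ i j = trans (cong +_ (ℕP.^-distribˡ-+-* 2 i j)) (ℤP.pos-* (2 ^ i) (2 ^ j))

  invertible-pow : ∀ j → Invertible (pow j)
  invertible-pow zero = + 1 , ≈-refl
  invertible-pow (suc j) = subst Invertible (sym (ℤP.pos-* 2 (2 ^ j)))
    (invertible-* {+ 2} {pow j} (invertible-2 odd) (invertible-pow j))

  pow-∸ : ∀ {i j} → i ≤ j → pow i ≈ pow j → pow (j ∸ i) ≈ + 1
  pow-∸ {i} {j} i≤j pow-i≈pow-j = *-cancelˡ {pow i} {pow (j ∸ i)} {+ 1} (invertible-pow i) (begin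
    pow i * pow (j ∸ i)   ≡⟨ pow-+ i (j ∸ i) ⟨
    pow (i ℕ.+ (j ∸ i))   ≡⟨ cong pow (ℕP.m+[n∸m]≡n i≤j) ⟩
    pow j                 ≈⟨ pow-i≈pow-j ⟨
    pow i                 ≡⟨ ℤP.*-identityʳ (pow i) ⟨
    pow i * + 1           ∎)
    where open import Relation.Binary.Reasoning.Setoid ≈-setoid

  period-exists : ∃ λ k → 0 < k × pow k ≈ + 1
  period-exists with FP.pigeonhole (ℕP.n<1+n n) (λ i → Fin.fromℕ< (rem<n (pow (Fin.toℕ i))))
  ... | i , j , i<j , ri≡rj = Fin.toℕ j ∸ Fin.toℕ i , ℕP.m<n⇒0<n∸m i<j , pow-∸ (ℕP.<⇒≤ i<j) pow-i≈pow-j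
    where
    pow-i≈pow-j : pow (Fin.toℕ i) ≈ pow (Fin.toℕ j)
    pow-i≈pow-j = rem-≡⇒≈ (pow (Fin.toℕ i)) (pow (Fin.toℕ j))
      (FP.fromℕ<-injective _ _ (rem<n (pow (Fin.toℕ i))) (rem<n (pow (Fin.toℕ j))) ri≡rj)

  -- The detour through order-below keeps 'with' from abstracting over, and normalising, period-exists.
  order-exists : ∃ (IsMultOrder n 2)
  order-exists = order-below (proj₂ period-exists)
    where
    order-below : ∀ {k} → 0 < k × pow k ≈ + 1 → ∃ (IsMultOrder n 2)
    order-below period with ∃-least (λ k → (0 ℕ.<? k) ×-dec (pow k ≈? + 1)) period
    ... | d , (0<d , pow-d≈1) , least =
      d , 0<d , ≈⇒∣ᵤ {pow d} {+ 1} pow-d≈1 , λ m 0<m n∣2^m-1 → least (0<m , ∣ᵤ⇒≈ {pow m} {+ 1} n∣2^m-1)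

  module Order {d : ℕ} (ord : IsMultOrder n 2 d) where

    instance
      d-nonZero : NonZero d
      d-nonZero = ℕ.>-nonZero (proj₁ ord)

    pow-order : pow d ≈ + 1
    pow-order = ∣ᵤ⇒≈ (proj₁ (proj₂ ord))

    order-minimal : ∀ {m} → 0 < m → pow m ≈ + 1 → d ≤ m
    order-minimal {m} 0<m pow-m≈1 = proj₂ (proj₂ ord) m 0<m (≈⇒∣ᵤ pow-m≈1)

    pow-+-multiple : ∀ r q → pow (r ℕ.+ q ℕ.* d) ≈ pow r
    pow-+-multiple r zero = ≈-reflexive (cong pow (ℕP.+-identityʳ r))
    pow-+-multiple r (suc q) = begin
      pow (r ℕ.+ (d ℕ.+ q ℕ.* d))    ≡⟨ cong pow (ℕP.+-assoc r d (q ℕ.* d)) ⟨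
      pow (r ℕ.+ d ℕ.+ q ℕ.* d)      ≈⟨ pow-+-multiple (r ℕ.+ d) q ⟩
      pow (r ℕ.+ d)                  ≡⟨ pow-+ r d ⟩
      pow r * pow d                  ≈⟨ *-cong (≈-refl {pow r}) pow-order ⟩
      pow r * + 1                    ≡⟨ ℤP.*-identityʳ (pow r) ⟩
      pow r                          ∎
      where open import Relation.Binary.Reasoning.Setoid ≈-setoid

    pow-mod : ∀ j → pow j ≈ pow (j ℕ.% d)
    pow-mod j = begin
      pow j                              ≡⟨ cong pow (ℕDM.m≡m%n+[m/n]*n j d) ⟩
      pow (j ℕ.% d ℕ.+ (j ℕ./ d) ℕ.* d)  ≈⟨ pow-+-multiple (j ℕ.% d) (j ℕ./ d) ⟩
      pow (j ℕ.% d)                      ∎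
      where open import Relation.Binary.Reasoning.Setoid ≈-setoid

    pow≈1⇒%≡0 : ∀ {m} → pow m ≈ + 1 → m ℕ.% d ≡ 0
    pow≈1⇒%≡0 {m} pow-m≈1 with m ℕ.% d | ℕDM.m%n<n m d | pow-mod m
    ... | zero | _ | _ = refl
    ... | suc r | r<d | pow-m≈pow-r =
      contradiction (order-minimal z<s (≈-trans (≈-sym pow-m≈pow-r) pow-m≈1)) (ℕP.<⇒≱ r<d)

    pow-distinct : ∀ {i j} → i < j → j < d → ¬ pow i ≈ pow j
    pow-distinct {i} {j} i<j j<d pow-i≈pow-j = ℕP.<⇒≱ j<d (ℕP.≤-trans
      (order-minimal (ℕP.m<n⇒0<n∸m i<j) (pow-∸ (ℕP.<⇒≤ i<j) pow-i≈pow-j)) (ℕP.m∸n≤m j i))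

    double≡order : ∀ {k} → 0 < k → k < d → pow (k ℕ.+ k) ≈ + 1 → k ℕ.+ k ≡ d
    double≡order {k@(suc _)} _ k<d pow-2k≈1 with ℕD.m%n≡0⇒n∣m (k ℕ.+ k) d (pow≈1⇒%≡0 pow-2k≈1)
    ... | divides 1 2k≡d = trans 2k≡d (ℕP.+-identityʳ d)
    ... | divides (suc (suc q)) 2k≡[2+q]d = contradiction 2k≡[2+q]d
      (ℕP.<⇒≢ (ℕP.<-≤-trans (ℕP.+-mono-< k<d k<d) (ℕP.+-monoʳ-≤ d (ℕP.m≤m+n d (q ℕ.* d)))))

    powerResidues negPowerResidues : List ℕ
    powerResidues = applyUpTo (λ j → rem (pow j)) d
    negPowerResidues = applyUpTo (λ j → rem (- pow j)) d

    powerResidues-unique : Unique powerResidues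
    powerResidues-unique = Unique.applyUpTo⁺₁ _ d λ {i} {j} i<j j<d ri≡rj →
      pow-distinct i<j j<d (rem-≡⇒≈ (pow i) (pow j) ri≡rj)

    negPowerResidues-unique : Unique negPowerResidues
    negPowerResidues-unique = Unique.applyUpTo⁺₁ _ d λ {i} {j} i<j j<d ri≡rj →
      pow-distinct i<j j<d (-‿cancel (rem-≡⇒≈ (- pow i) (- pow j) ri≡rj))

    ∈-powerResidues⁺ : ∀ {x} j → x ≈ pow j → rem x ∈ powerResidues
    ∈-powerResidues⁺ {x} j x≈pow-j =
      subst (_∈ powerResidues) (rem-cong (≈-sym (≈-trans x≈pow-j (pow-mod j))))
        (∈-applyUpTo⁺ (λ j → rem (pow j)) (ℕDM.m%n<n j d))

    ∈-negPowerResidues⁺ : ∀ {x} j → x ≈ - pow j → rem x ∈ negPowerResidues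
    ∈-negPowerResidues⁺ {x} j x≈-pow-j =
      subst (_∈ negPowerResidues) (rem-cong (≈-sym (≈-trans x≈-pow-j (-‿cong (pow-mod j)))))
        (∈-applyUpTo⁺ (λ j → rem (- pow j)) (ℕDM.m%n<n j d))

    ∈-powerResidues⁻ : ∀ {c} → c ∈ powerResidues → ∃ λ j → j < d × c ≡ rem (pow j)
    ∈-powerResidues⁻ = ∈-applyUpTo⁻ _

    ∈-negPowerResidues⁻ : ∀ {c} → c ∈ negPowerResidues → ∃ λ j → j < d × c ≡ rem (- pow j)
    ∈-negPowerResidues⁻ = ∈-applyUpTo⁻ _

    powerResidues⊆reducedResidues : powerResidues ⊆ reducedResidues
    powerResidues⊆reducedResidues c∈ with ∈-powerResidues⁻ c∈
    ... | j , _ , refl = rem∈reducedResidues (pow j) (invertible⇒coprime (invertible-pow j))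

    negPowerResidues⊆reducedResidues : negPowerResidues ⊆ reducedResidues
    negPowerResidues⊆reducedResidues c∈ with ∈-negPowerResidues⁻ c∈
    ... | j , _ , refl = rem∈reducedResidues (- pow j)
      (subst (λ m → Coprime m n) (sym (ℤP.∣-i∣≡∣i∣ (pow j))) (invertible⇒coprime (invertible-pow j)))

    MinusOneIsPower : Set
    MinusOneIsPower = ∃ λ k → pow k ≈ - + 1

    minusOneIsPower? : Dec MinusOneIsPower
    minusOneIsPower? = Dec.map′ (λ (k , _ , pow-k≈-1) → k , pow-k≈-1)
      (λ (k , pow-k≈-1) → k ℕ.% d , ℕDM.m%n<n k d , ≈-trans (≈-sym (pow-mod k)) pow-k≈-1)
      (ℕP.anyUpTo? (λ k → pow k ≈? - + 1) d)

    negPowerResidues⊆powerResidues : MinusOneIsPower → negPowerResidues ⊆ powerResidues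
    negPowerResidues⊆powerResidues (k , pow-k≈-1) c∈ with ∈-negPowerResidues⁻ c∈
    ... | j , _ , refl = ∈-powerResidues⁺ (k ℕ.+ j) (begin
      - pow j              ≡⟨ ℤP.-1*i≡-i (pow j) ⟨
      - + 1 * pow j        ≈⟨ *-cong pow-k≈-1 (≈-refl {pow j}) ⟨
      pow k * pow j        ≡⟨ pow-+ k j ⟨
      pow (k ℕ.+ j)        ∎)
      where open import Relation.Binary.Reasoning.Setoid ≈-setoid

    powerResidues-disjoint : ¬ MinusOneIsPower → Disjoint powerResidues negPowerResidues
    powerResidues-disjoint ¬-1∈⟨2⟩ (c∈ , c∈neg) with ∈-powerResidues⁻ c∈ | ∈-negPowerResidues⁻ c∈neg
    ... | i , _ , refl | j , j<d , ri≡r-j = ¬-1∈⟨2⟩ (i ℕ.+ (d ∸ j) , (begin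
      pow (i ℕ.+ (d ∸ j))            ≡⟨ pow-+ i (d ∸ j) ⟩
      pow i * pow (d ∸ j)            ≈⟨ *-cong (rem-≡⇒≈ (pow i) (- pow j) ri≡r-j) ≈-refl ⟩
      - pow j * pow (d ∸ j)          ≡⟨ ℤP.neg-distribˡ-* (pow j) (pow (d ∸ j)) ⟨
      - (pow j * pow (d ∸ j))        ≡⟨ cong -_ (pow-+ j (d ∸ j)) ⟨
      - pow (j ℕ.+ (d ∸ j))          ≡⟨ cong (λ m → - pow m) (ℕP.m+[n∸m]≡n (ℕP.<⇒≤ j<d)) ⟩
      - pow d                        ≈⟨ -‿cong pow-order ⟩
      - + 1                          ∎))
      where open import Relation.Binary.Reasoning.Setoid ≈-setoid

    length-powerResidues : length powerResidues ≡ d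
    length-powerResidues = length-applyUpTo _ d

    length-±powerResidues : length (powerResidues ++ negPowerResidues) ≡ d ℕ.+ d
    length-±powerResidues =
      trans (length-++ powerResidues) (cong₂ ℕ._+_ length-powerResidues (length-applyUpTo _ d))

    InOFS⇔⊆±powerResidues : InOFS n ⇔ reducedResidues ⊆ powerResidues ++ negPowerResidues
    InOFS⇔⊆±powerResidues = mk⇔ covered represented
      where
      covered : InOFS n → reducedResidues ⊆ powerResidues ++ negPowerResidues
      covered inOFS {c} c∈ with ∈-reducedResidues⁻ c∈
      ... | c<n , c⊥n with inOFS (+ c) c⊥n
      ... | j , inj₁ n∣c-2^j = ∈-++⁺ˡ (subst (_∈ powerResidues) (rem-+ c<n)
                                 (∈-powerResidues⁺ j (∣ᵤ⇒≈ {+ c} {pow j} n∣c-2^j)))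
      ... | j , inj₂ n∣c+2^j = ∈-++⁺ʳ powerResidues (subst (_∈ negPowerResidues) (rem-+ c<n)
                                 (∈-negPowerResidues⁺ j (∣ᵤ+⇒≈- {+ c} {pow j} n∣c+2^j)))
      represented : reducedResidues ⊆ powerResidues ++ negPowerResidues → InOFS n
      represented ⊆±pow x x⊥n with ∈-++⁻ powerResidues (⊆±pow (rem∈reducedResidues x x⊥n))
      ... | inj₁ r∈ = let j , _ , rx≡ = ∈-powerResidues⁻ r∈ in
        j , inj₁ (≈⇒∣ᵤ (rem-≡⇒≈ x (pow j) rx≡))
      ... | inj₂ r∈ = let j , _ , rx≡ = ∈-negPowerResidues⁻ r∈ in
        j , inj₂ (≈-⇒∣ᵤ+ {x} {pow j} (rem-≡⇒≈ x (- pow j) rx≡))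

    minusOneIsNotPower : n ≢ 1 → φ n ≡ d ℕ.+ d →
      ¬ (4 ℕD.∣ φ n) ⊎ ¬ (n ℕD.∣ 2 ^ (φ n ℕ./ 4) ℕ.+ 1) → ¬ MinusOneIsPower
    minusOneIsNotPower n≢1 φ≡d+d conditions (k , pow-k≈-1) = refute conditions
      where
      r = k ℕ.% d
      pow-r≈-1 : pow r ≈ - + 1
      pow-r≈-1 = ≈-trans (≈-sym (pow-mod k)) pow-k≈-1
      positive : ∀ {j} → pow j ≈ - + 1 → 0 < j
      positive {zero} 1≈-1 = contradiction 1≈-1 (1≉-1 odd n≢1)
      positive {suc j} _ = z<s
      r+r≡d : r ℕ.+ r ≡ d
      r+r≡d = double≡order (positive pow-r≈-1) (ℕDM.m%n<n k d)
        (≈-trans (≈-reflexive (pow-+ r r)) (*-cong pow-r≈-1 pow-r≈-1))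
      φ≡r*4 : φ n ≡ r ℕ.* 4
      φ≡r*4 = trans φ≡d+d (trans (cong (λ m → m ℕ.+ m) (sym r+r≡d)) (quadruple r))
        where
        quadruple : ∀ r → (r ℕ.+ r) ℕ.+ (r ℕ.+ r) ≡ r ℕ.* 4
        quadruple = ℕSolver.solve-∀
      refute : ¬ (4 ℕD.∣ φ n) ⊎ ¬ (n ℕD.∣ 2 ^ (φ n ℕ./ 4) ℕ.+ 1) → ⊥
      refute (inj₁ 4∤φ) = 4∤φ (divides r φ≡r*4)
      refute (inj₂ n∤2^[φ/4]+1) = n∤2^[φ/4]+1 (subst (λ m → n ℕD.∣ 2 ^ m ℕ.+ 1)
        (sym (trans (cong (ℕ._/ 4) φ≡r*4) (ℕDM.m*n/n≡m r 4))) (≈-⇒∣ᵤ+ {pow r} {+ 1} pow-r≈-1))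

    ⊇powerResidues⇔φ≡order : reducedResidues ⊆ powerResidues ⇔ φ n ≡ d
    ⊇powerResidues⇔φ≡order = mk⇔
      (λ (⊇ : reducedResidues ⊆ powerResidues) → trans (to counting ⊇) length-powerResidues)
      (λ φ≡d → from counting (trans φ≡d (sym length-powerResidues)))
      where counting = ⊇reducedResidues⇔φ≡length powerResidues-unique powerResidues⊆reducedResidues

    φ≡order⇒InOFS : φ n ≡ d → InOFS n
    φ≡order⇒InOFS φ≡d = from InOFS⇔⊆±powerResidues (∈-++⁺ˡ ∘ from ⊇powerResidues⇔φ≡order φ≡d)

    InOFS⇒φ≡order : InOFS n → MinusOneIsPower → φ n ≡ d
    InOFS⇒φ≡order inOFS -1∈⟨2⟩ = to ⊇powerResidues⇔φ≡order ⊆powerResidues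
      where
      ⊆powerResidues : reducedResidues ⊆ powerResidues
      ⊆powerResidues c∈ with ∈-++⁻ powerResidues (to InOFS⇔⊆±powerResidues inOFS c∈)
      ... | inj₁ c∈pow = c∈pow
      ... | inj₂ c∈neg = negPowerResidues⊆powerResidues -1∈⟨2⟩ c∈neg

    module _ (-1∉⟨2⟩ : ¬ MinusOneIsPower) where

      ±powerResidues-unique : Unique (powerResidues ++ negPowerResidues)
      ±powerResidues-unique =
        Unique.++⁺ powerResidues-unique negPowerResidues-unique (powerResidues-disjoint -1∉⟨2⟩)

      ±powerResidues⊆reducedResidues : powerResidues ++ negPowerResidues ⊆ reducedResidues
      ±powerResidues⊆reducedResidues c∈ with ∈-++⁻ powerResidues c∈
      ... | inj₁ c∈pow = powerResidues⊆reducedResidues c∈pow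
      ... | inj₂ c∈neg = negPowerResidues⊆reducedResidues c∈neg

      InOFS⇔φ≡2·order : InOFS n ⇔ φ n ≡ d ℕ.+ d
      InOFS⇔φ≡2·order = mk⇔
        (λ inOFS → trans (to counting (to InOFS⇔⊆±powerResidues inOFS)) length-±powerResidues)
        (λ φ≡d+d → from InOFS⇔⊆±powerResidues (from counting (trans φ≡d+d (sym length-±powerResidues))))
        where counting = ⊇reducedResidues⇔φ≡length ±powerResidues-unique ±powerResidues⊆reducedResidues

  Criterion : Set
  Criterion = IsMultOrder n 2 (φ n) ⊎
    (IsMultOrder n 2 (φ n ℕ./ 2) × (¬ (4 ℕD.∣ φ n) ⊎ ¬ (n ℕD.∣ 2 ^ (φ n ℕ./ 4) ℕ.+ 1)))

  InOFS⇒criterion : InOFS n → Criterion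
  InOFS⇒criterion = from-order (proj₂ order-exists)
    where
    from-order : ∀ {d} → IsMultOrder n 2 d → InOFS n → Criterion
    from-order {d} ord inOFS with Order.minusOneIsPower? ord
    ... | yes -1∈⟨2⟩ = inj₁ (subst (IsMultOrder n 2) (sym (Order.InOFS⇒φ≡order ord inOFS -1∈⟨2⟩)) ord)
    ... | no -1∉⟨2⟩ = inj₂ (subst (IsMultOrder n 2) (sym φ/2≡d) ord , inj₂ λ n∣2^[φ/4]+1 →
                              -1∉⟨2⟩ (φ n ℕ./ 4 , ∣ᵤ+⇒≈- {pow (φ n ℕ./ 4)} {+ 1} n∣2^[φ/4]+1))
      where
      φ/2≡d : φ n ℕ./ 2 ≡ d
      φ/2≡d = trans (cong (ℕ._/ 2) (to (Order.InOFS⇔φ≡2·order ord -1∉⟨2⟩) inOFS)) (double/2≡ d)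

  criterion⇒InOFS : Criterion → InOFS n
  criterion⇒InOFS (inj₁ ord) = Order.φ≡order⇒InOFS ord refl
  criterion⇒InOFS (inj₂ (ord , conditions)) = from (Order.InOFS⇔φ≡2·order ord -1∉⟨2⟩) φ≡d+d
    where
    n≢1 : n ≢ 1
    n≢1 = φ/2-positive⇒≢1 (proj₁ ord)
    φ≡d+d : φ n ≡ φ n ℕ./ 2 ℕ.+ φ n ℕ./ 2
    φ≡d+d = even⇒≡half+half (φ-even odd n≢1)
    -1∉⟨2⟩ = Order.minusOneIsNotPower ord n≢1 φ≡d+d conditions

open import Data.Nat using (ℕ; _^_; _/_; _≤_; _+_)
open import Data.Nat.Divisibility using (_∣_)
open import Data.Product using (_×_)
open import Data.Sum using (_⊎_)
open import Relation.Nullary using (¬_)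
open import Function.Bundles using (_⇔_)

proposition3p7 : ∀ (n : ℕ) → 1 ≤ n → Odd n →
    (InOFS n ⇔
      (IsMultOrder n 2 (φ n) ⊎
       (IsMultOrder n 2 (φ n / 2) ×
        (¬ (4 ∣ φ n) ⊎ ¬ (n ∣ (2 ^ (φ n / 4) + 1))))))
proposition3p7 n 1≤n odd = mk⇔ InOFS⇒criterion criterion⇒InOFS
  where
  instance
    n-nonZero : NonZero n
    n-nonZero = ℕ.>-nonZero 1≤n
  open PowersOfTwo n odd
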